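{- Let $q$ be a prime power, $d$ a positive integer, $f=x^d\in\mathbb{F}_q[x]$ and $m=\gcd(d-1,q-1)$. If $m(m+1)\ge q-1$, then $\deg(S_f)=m+1$.
   Context: $\mathrm{PG}(2,q)$ is the projective plane over $\mathbb{F}_q$. For $f\in\mathbb{F}_q[x]$, $S_f=\{(x,f(x),1):x\in\mathbb{F}_q\}\cup\{(0,1,0)\}$. For a set $D$ of $q+1$ points, $u_i(D)$ is the number of lines of $\mathrm{PG}(2,q)$ containing exactly $i$ points of $D$, and $\deg(D)$ is the largest $i$ with $u_i(D)\neq 0$. -}

module Defs where

open import Data.Nat as ℕ using (ℕ; zero; suc; _≤_; _<_)
open import Data.Nat.Primality using (Prime)
open import Data.Product using (_×_; _,_; ∃; Σ)
open import Data.List using (List; []; _∷_; _++_; map; concatMap; filter; length)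
open import Data.List.Membership.Propositional using (_∈_)
open import Data.List.Relation.Unary.Unique.Propositional using (Unique)
open import Relation.Binary.PropositionalEquality using (_≡_; _≢_)
open import Relation.Binary.Definitions using (DecidableEquality)
open import Relation.Nullary using (¬_)
open import Algebra.Structures using (IsCommutativeRing)

IsPrimePower : ℕ → Set
IsPrimePower q = Σ ℕ λ p → Σ ℕ λ k → Prime p × 1 ≤ k × q ≡ p ℕ.^ k

record FiniteField (q : ℕ) : Set₁ where
  infixl 6 _+_
  infixl 7 _*_
  field
    Carrier  : Set
    _+_ _*_  : Carrier → Carrier → Carrier
    -_       : Carrier → Carrier
    0# 1#    : Carrier
    isCommutativeRing : IsCommutativeRing _≡_ _+_ _*_ -_ 0# 1#
    0≢1      : 0# ≢ 1#
    inverse  : ∀ x → x ≢ 0# → ∃ λ y → x * y ≡ 1#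
    _≟_      : DecidableEquality Carrier
    elements : List Carrier
    elements-unique   : Unique elements
    elements-complete : ∀ x → x ∈ elements
    elements-size     : length elements ≡ q

module PG2 {q : ℕ} (F : FiniteField q) where
  open FiniteField F

  pow : Carrier → ℕ → Carrier
  pow x zero    = 1#
  pow x (suc n) = x * pow x n

  Triple : Set
  Triple = Carrier × Carrier × Carrier

  -- Points of PG(2,q), each by its unique normalized representative:
  -- (x,y,1), (x,1,0), (1,0,0).
  points : List Triple
  points = concatMap (λ x → map (λ y → (x , y , 1#)) elements) elements
           ++ map (λ x → (x , 1# , 0#)) elements
           ++ ((1# , 0# , 0#) ∷ [])

  -- Lines [a,b,c] of PG(2,q) (same normalization); the point (x,y,z)
  -- lies on the line [a,b,c] iff a x + b y + c z = 0.
  lines : List Triple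
  lines = points

  dot : Triple → Triple → Carrier
  dot (x , y , z) (a , b , c) = a * x + b * y + c * z

  Incident : Triple → Triple → Set
  Incident P L = dot P L ≡ 0#

  pointsOn : List Triple → Triple → ℕ
  pointsOn D L = length (filter (λ P → _≟_ (dot P L) 0#) D)

  u : ℕ → List Triple → ℕ
  u i D = length (filter (λ L → pointsOn D L ℕ.≟ i) lines)

  HasDegree : List Triple → ℕ → Set
  HasDegree D k = ¬ (u k D ≡ 0) × (∀ i → k < i → u i D ≡ 0)

  S : (Carrier → Carrier) → List Triple
  S f = map (λ x → (x , f x , 1#)) elements ++ ((0# , 1# , 0#) ∷ [])

{-# OPTIONS --safe #-}
module Submission where

-- Write d = D + 1, m = gcd D (q − 1) and q − 1 = k m. A line meets S_f in the points
-- (x, x^d, 1) with x a root of a polynomial, plus possibly (0,1,0), and a polynomial of degree n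
-- has at most n roots. By Fermat (x^(q−1) = 1 for x ≠ 0) and Bézout for m, x^D determines x^m on
-- units. Hence on a line y = −a x all nonzero points satisfy x^m = x₀^m for one of them, x₀,
-- giving at most m + 1 points; on a x + b y + 1 = 0 with b ≠ 0 a point is determined by x^D, a
-- k-th root of unity, giving at most k ≤ m + 1 points (this is where q − 1 ≤ m (m + 1) enters);
-- lines through (0,1,0) carry at most 2 points. The line y = x attains m + 1: an x off it has
-- x^m ≠ 1 = (x^m)^k, so it is a root of 1 + x^m + ⋯ + x^(m (k − 1)), and at most (k − 1) m of
-- the q field elements are such roots.

open import Defs
open import Data.Nat as ℕ using (ℕ; zero; suc; _≤_; _∸_; NonZero; z≤n; s≤s)
open import Data.Nat.GCD using (gcd; gcd-GCD; gcd[m,n]∣m; gcd[m,n]∣n; gcd[m,n]≢0; module Bézout)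
open Bézout.Identity using (+-; -+)
open import Data.Nat.Divisibility using (_∣_; divides; *-monoˡ-∣)
import Data.Nat.Properties as ℕ
open import Data.Product using (_×_; _,_; ∃; proj₂)
open import Data.Sum using (_⊎_; inj₁; inj₂)
open import Data.Maybe using (nothing)
open import Data.List using (List; []; _∷_; _++_; map; filter; length; foldr; concatMap)
open import Data.List.Membership.Propositional using (_∈_; lose; find)
open import Data.List.Relation.Unary.Any using (here; there)
open import Data.List.Relation.Unary.All as All using (All; []; _∷_; all?)
import Data.List.Relation.Unary.All.Properties as All
open import Data.List.Relation.Unary.Unique.Propositional using (Unique)
open import Data.List.Relation.Unary.AllPairs using ([]; _∷_)
import Data.List.Relation.Unary.Unique.Propositional.Properties as Unique
import Data.List.Membership.Propositional.Properties as ∈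
open import Data.List.Membership.Propositional.Properties.WithK using (unique∧set⇒bag)
open import Data.List.Relation.Binary.BagAndSetEquality using (∼bag⇒↭)
open import Data.List.Relation.Binary.Permutation.Propositional using (_↭_; ↭⇒↭ₛ)
open import Data.List.Relation.Binary.Permutation.Propositional.Properties using (↭-length)
import Data.List.Relation.Binary.Permutation.Setoid.Properties as ↭ₛ
import Data.List.Properties as List
open import Function.Base using (_∘_)
open import Function.Bundles using (_⇔_; mk⇔)
open import Relation.Binary.PropositionalEquality
open import Relation.Nullary using (yes; no; ¬?; contradiction)
open import Relation.Unary using (Decidable)
open import Relation.Unary.Properties using (∁?)
open import Algebra.Bundles using (CommutativeRing; CancellativeCommutativeSemiring)
open import Algebra.Definitions using (AlmostLeftCancellative)
import Algebra.Properties.Semiring.Exp as Exp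
import Algebra.Properties.Group as GroupProperties
import Algebra.Properties.CancellativeCommutativeSemiring as CancellativeProperties
import Algebra.Properties.CommutativeSemigroup as CommutativeSemigroupProperties
open import Tactic.RingSolver.Core.AlmostCommutativeRing using (fromCommutativeRing)

↭-from-members : ∀ {A : Set} {xs ys : List A} → Unique xs → Unique ys →
                 (∀ {z} → z ∈ xs ⇔ z ∈ ys) → xs ↭ ys
↭-from-members xs! ys! same = ∼bag⇒↭ (unique∧set⇒bag xs! ys! same)

length-filter-map : ∀ {A B : Set} {P : B → Set} (P? : Decidable P) (f : A → B) xs →
                    length (filter P? (map f xs)) ≡ length (filter (P? ∘ f) xs)
length-filter-map P? f []       = refl
length-filter-map P? f (x ∷ xs) with P? (f x)
... | yes _ = cong suc (length-filter-map P? f xs)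
... | no  _ = length-filter-map P? f xs

length-filter+length-filter-∁ : ∀ {A : Set} {P : A → Set} (P? : Decidable P) xs →
                                length (filter P? xs) ℕ.+ length (filter (∁? P?) xs) ≡ length xs
length-filter+length-filter-∁ P? []       = refl
length-filter+length-filter-∁ P? (x ∷ xs) with P? x
... | yes _ = cong suc (length-filter+length-filter-∁ P? xs)
... | no  _ = trans (ℕ.+-suc _ _) (cong suc (length-filter+length-filter-∁ P? xs))

Unique-map⁺-on : ∀ {A B : Set} {P : A → Set} {f : A → B} {xs} →
                 (∀ {x y} → P x → P y → f x ≡ f y → x ≡ y) → All P xs → Unique xs → Unique (map f xs)
Unique-map⁺-on f-inj []         []           = []
Unique-map⁺-on f-inj (px ∷ pxs) (x∉xs ∷ xs!) =
  All.map⁺ (All.zipWith (λ (py , x≢y) fx≡fy → x≢y (f-inj px py fx≡fy)) (pxs , x∉xs)) ∷ Unique-map⁺-on f-inj pxs xs!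

module _ {q : ℕ} (F : FiniteField q) where
  open FiniteField F
  open PG2 F

  commutativeRing : CommutativeRing _ _
  commutativeRing = record { isCommutativeRing = isCommutativeRing }

  open CommutativeRing commutativeRing
    using (_-_; semiring; +-group; *-isCommutativeMonoid; *-commutativeSemigroup; isCommutativeSemiring;
           +-assoc; +-comm; -‿inverseˡ; *-assoc; *-comm; *-identityˡ; *-identityʳ; zeroˡ; zeroʳ; +-identityˡ; +-identityʳ)
  open Exp semiring using (_^_; ^-homo-*; ^-assocʳ)
  open CommutativeSemigroupProperties *-commutativeSemigroup using () renaming (interchange to *-interchange)
  open GroupProperties +-group using ()
    renaming (x∙y⁻¹≈ε⇒x≈y to x-y≡0⇒x≡y; x≈y⇒x∙y⁻¹≈ε to x≡y⇒x-y≡0; ∙-cancelˡ to +-cancelˡ; ∙-cancelʳ to +-cancelʳ)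

  -- Field constants are opaque to the solver, so it only gets identities that need no cancellation
  -- of coefficients: subtractions are first split off with t≡[t-r]+r, and 1# is passed as a variable.
  open import Tactic.RingSolver.NonReflective (fromCommutativeRing commutativeRing (λ _ → nothing))
    using (solve; _⊜_; _⊕_; _⊗_)

  *-cancelˡ-nonZero : AlmostLeftCancellative _≡_ 0# _*_
  *-cancelˡ-nonZero x y z x≢0 xy≡xz with inverse x x≢0
  ... | x⁻¹ , xx⁻¹≡1 = begin
    y                ≡⟨ unit y ⟩
    x⁻¹ * (x * y)    ≡⟨ cong (x⁻¹ *_) xy≡xz ⟩
    x⁻¹ * (x * z)    ≡⟨ unit z ⟨
    z                ∎
    where
    open ≡-Reasoning
    unit : ∀ w → w ≡ x⁻¹ * (x * w)
    unit w = begin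
      w                ≡⟨ *-identityˡ w ⟨
      1# * w           ≡⟨ cong (_* w) (trans (sym xx⁻¹≡1) (*-comm x x⁻¹)) ⟩
      (x⁻¹ * x) * w    ≡⟨ *-assoc x⁻¹ x w ⟩
      x⁻¹ * (x * w)    ∎

  cancellativeCommutativeSemiring : CancellativeCommutativeSemiring _ _
  cancellativeCommutativeSemiring = record
    { isCancellativeCommutativeSemiring = record
      { isCommutativeSemiring = isCommutativeSemiring
      ; *-cancelˡ-nonZero = *-cancelˡ-nonZero } }

  open CancellativeCommutativeSemiring cancellativeCommutativeSemiring using (*-cancelʳ-nonZero)
  open CancellativeProperties cancellativeCommutativeSemiring using (x≉0∧y≉0⇒xy≉0)

  x≢0∧y≢0⇒xy≢0 : ∀ {x y} → x ≢ 0# → y ≢ 0# → x * y ≢ 0#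
  x≢0∧y≢0⇒xy≢0 = x≉0∧y≉0⇒xy≉0 _≟_

  x≢0∧xy≡0⇒y≡0 : ∀ {x y} → x ≢ 0# → x * y ≡ 0# → y ≡ 0#
  x≢0∧xy≡0⇒y≡0 {x} {y} x≢0 xy≡0 = *-cancelˡ-nonZero x y 0# x≢0 (trans xy≡0 (sym (zeroʳ x)))

  1≢0 : 1# ≢ 0#
  1≢0 = 0≢1 ∘ sym

  pow≡^ : ∀ x n → pow x n ≡ x ^ n
  pow≡^ x zero    = refl
  pow≡^ x (suc n) = cong (x *_) (pow≡^ x n)

  x*c+1≡0⇒x≢0 : ∀ {x c} → x * c + 1# ≡ 0# → x ≢ 0#
  x*c+1≡0⇒x≢0 {c = c} root refl = 1≢0 (trans (sym (trans (cong (_+ 1#) (zeroˡ c)) (+-identityˡ 1#))) root)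

  x*c+1≡0⇒c≢0 : ∀ {x c} → x * c + 1# ≡ 0# → c ≢ 0#
  x*c+1≡0⇒c≢0 {x} root refl = 1≢0 (trans (sym (trans (cong (_+ 1#) (zeroʳ x)) (+-identityˡ 1#))) root)

  1^n≡1 : ∀ n → 1# ^ n ≡ 1#
  1^n≡1 zero    = refl
  1^n≡1 (suc n) = trans (*-identityˡ _) (1^n≡1 n)

  ^-nonZero : ∀ {x} n → x ≢ 0# → x ^ n ≢ 0#
  ^-nonZero zero    _   = 1≢0
  ^-nonZero (suc n) x≢0 = x≢0∧y≢0⇒xy≢0 x≢0 (^-nonZero n x≢0)

  -- Fermat's little theorem

  units : List Carrier
  units = filter (λ x → ¬? (x ≟ 0#)) elements

  ∈-units⁺ : ∀ {x} → x ≢ 0# → x ∈ units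
  ∈-units⁺ = ∈.∈-filter⁺ (λ x → ¬? (x ≟ 0#)) (elements-complete _)

  ∈-units⁻ : ∀ {x} → x ∈ units → x ≢ 0#
  ∈-units⁻ = proj₂ ∘ ∈.∈-filter⁻ (λ x → ¬? (x ≟ 0#)) {xs = elements}

  units-unique : Unique units
  units-unique = Unique.filter⁺ (λ x → ¬? (x ≟ 0#)) elements-unique

  elements↭0∷units : elements ↭ 0# ∷ units
  elements↭0∷units = ↭-from-members elements-unique (0∉units ∷ units-unique)
    (mk⇔ split (λ _ → elements-complete _))
    where
    0∉units : All (0# ≢_) units
    0∉units = All.tabulate (λ x∈units 0≡x → ∈-units⁻ x∈units (sym 0≡x))
    split : ∀ {x} → x ∈ elements → x ∈ 0# ∷ units
    split {x} _ with x ≟ 0#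
    ... | yes x≡0 = here x≡0
    ... | no  x≢0 = there (∈-units⁺ x≢0)

  q≡1+|units| : q ≡ suc (length units)
  q≡1+|units| = trans (sym elements-size) (↭-length elements↭0∷units)

  length-units : length units ≡ q ∸ 1
  length-units = cong (_∸ 1) (sym q≡1+|units|)

  q≡1+[q∸1] : q ≡ suc (q ∸ 1)
  q≡1+[q∸1] = trans q≡1+|units| (cong suc length-units)

  instance
    q∸1-nonZero : NonZero (q ∸ 1)
    q∸1-nonZero = ℕ.>-nonZero (subst (0 ℕ.<_) length-units (∈.∈-length (∈-units⁺ 1≢0)))

  product : List Carrier → Carrier
  product = foldr _*_ 1#

  product-↭ : ∀ {xs ys} → xs ↭ ys → product xs ≡ product ys
  product-↭ xs↭ys = ↭ₛ.foldr-commMonoid (setoid Carrier) *-isCommutativeMonoid (↭⇒↭ₛ xs↭ys)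

  product-map-* : ∀ t xs → product (map (t *_) xs) ≡ t ^ length xs * product xs
  product-map-* t []       = sym (*-identityˡ 1#)
  product-map-* t (x ∷ xs) = trans (cong (t * x *_) (product-map-* t xs)) (*-interchange t x _ _)

  product-nonZero : ∀ {xs} → All (_≢ 0#) xs → product xs ≢ 0#
  product-nonZero []           = 1≢0
  product-nonZero (x≢0 ∷ xs≢0) = x≢0∧y≢0⇒xy≢0 x≢0 (product-nonZero xs≢0)

  units↭t*units : ∀ {t} → t ≢ 0# → units ↭ map (t *_) units
  units↭t*units {t} t≢0 with inverse t t≢0
  ... | t⁻¹ , tt⁻¹≡1 = ↭-from-members units-unique
    (Unique.map⁺ (*-cancelˡ-nonZero t _ _ t≢0) units-unique) (mk⇔ to from)
    where
    to : ∀ {x} → x ∈ units → x ∈ map (t *_) units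
    to {x} x∈units = subst (_∈ map (t *_) units) t[t⁻¹x]≡x
      (∈.∈-map⁺ (t *_) (∈-units⁺ (x≢0∧y≢0⇒xy≢0 t⁻¹≢0 (∈-units⁻ x∈units))))
      where
      t⁻¹≢0 : t⁻¹ ≢ 0#
      t⁻¹≢0 t⁻¹≡0 = 1≢0 (trans (sym tt⁻¹≡1) (trans (cong (t *_) t⁻¹≡0) (zeroʳ t)))
      t[t⁻¹x]≡x : t * (t⁻¹ * x) ≡ x
      t[t⁻¹x]≡x = trans (sym (*-assoc t t⁻¹ x)) (trans (cong (_* x) tt⁻¹≡1) (*-identityˡ x))
    from : ∀ {x} → x ∈ map (t *_) units → x ∈ units
    from x∈tunits with ∈.∈-map⁻ (t *_) x∈tunits
    ... | y , y∈units , refl = ∈-units⁺ (x≢0∧y≢0⇒xy≢0 t≢0 (∈-units⁻ y∈units))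

  fermat : ∀ {t} → t ≢ 0# → t ^ (q ∸ 1) ≡ 1#
  fermat {t} t≢0 = subst (λ n → t ^ n ≡ 1#) length-units
    (*-cancelˡ-nonZero (product units) _ _ (product-nonZero (All.tabulate ∈-units⁻)) (begin
      product units * t ^ length units    ≡⟨ *-comm _ _ ⟩
      t ^ length units * product units    ≡⟨ product-map-* t units ⟨
      product (map (t *_) units)          ≡⟨ product-↭ (units↭t*units t≢0) ⟨
      product units                       ≡⟨ *-identityʳ _ ⟨
      product units * 1#                  ∎))
    where open ≡-Reasoning

  fermat-multiple : ∀ {t} → t ≢ 0# → ∀ n → t ^ (n ℕ.* (q ∸ 1)) ≡ 1#
  fermat-multiple {t} t≢0 n = trans (sym (^-assocʳ t n (q ∸ 1))) (fermat (^-nonZero n t≢0))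

  -- Polynomial functions and their roots

  -- Horner form: the nonzero constant at the bottom is the leading coefficient, so n is the exact degree.
  data Polynomial : ℕ → (Carrier → Carrier) → Set where
    constant : ∀ {f} c → c ≢ 0# → (∀ t → f t ≡ c) → Polynomial 0 f
    horner   : ∀ {n f g} c → Polynomial n g → (∀ t → f t ≡ t * g t + c) → Polynomial (suc n) f

  Polynomial-cong : ∀ {n f g} → (∀ t → g t ≡ f t) → Polynomial n f → Polynomial n g
  Polynomial-cong g≗f (constant c c≢0 f≡) = constant c c≢0 (λ t → trans (g≗f t) (f≡ t))
  Polynomial-cong g≗f (horner c h-poly f≡) = horner c h-poly (λ t → trans (g≗f t) (f≡ t))

  t≡[t-r]+r : ∀ t r → t ≡ (t - r) + r
  t≡[t-r]+r t r = sym (begin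
    (t + - r) + r    ≡⟨ +-assoc t (- r) r ⟩
    t + (- r + r)    ≡⟨ cong (t +_) (-‿inverseˡ r) ⟩
    t + 0#           ≡⟨ +-identityʳ t ⟩
    t                ∎)
    where open ≡-Reasoning

  factor-theorem : ∀ {n f} → Polynomial (suc n) f → ∀ r →
                   ∃ λ h → Polynomial n h × (∀ t → f t ≡ (t - r) * h t + f r)
  factor-theorem {f = f} (horner {g = g} c (constant c₀ c₀≢0 g≡c₀) f≡) r =
    (λ _ → c₀) , constant c₀ c₀≢0 (λ _ → refl) , λ t → begin
      f t                           ≡⟨ f≡ t ⟩
      t * g t + c                   ≡⟨ cong (λ w → t * w + c) (g≡c₀ t) ⟩
      t * c₀ + c                    ≡⟨ cong (λ w → w * c₀ + c) (t≡[t-r]+r t r) ⟩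
      ((t - r) + r) * c₀ + c        ≡⟨ regroup (t - r) r c₀ c ⟩
      (t - r) * c₀ + (r * c₀ + c)   ≡⟨ cong (λ w → (t - r) * c₀ + (r * w + c)) (g≡c₀ r) ⟨
      (t - r) * c₀ + (r * g r + c)  ≡⟨ cong ((t - r) * c₀ +_) (f≡ r) ⟨
      (t - r) * c₀ + f r            ∎
    where
    open ≡-Reasoning
    regroup : ∀ u r c₀ c → (u + r) * c₀ + c ≡ u * c₀ + (r * c₀ + c)
    regroup = solve 4 (λ u r c₀ c → ((u ⊕ r) ⊗ c₀ ⊕ c) ⊜ (u ⊗ c₀ ⊕ (r ⊗ c₀ ⊕ c))) refl
  factor-theorem {f = f} (horner {g = g} c g-poly@(horner _ _ _) f≡) r
    with h , h-poly , g≡ ← factor-theorem g-poly r =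
    (λ t → t * h t + g r) , horner (g r) h-poly (λ _ → refl) , λ t → begin
      f t                                           ≡⟨ f≡ t ⟩
      t * g t + c                                   ≡⟨ cong (λ w → t * w + c) (g≡ t) ⟩
      t * ((t - r) * h t + g r) + c                 ≡⟨ cong (λ w → w * ((t - r) * h t + g r) + c) (t≡[t-r]+r t r) ⟩
      ((t - r) + r) * ((t - r) * h t + g r) + c     ≡⟨ regroup (t - r) r (h t) (g r) c ⟩
      (t - r) * (((t - r) + r) * h t + g r) + (r * g r + c)
                                                    ≡⟨ cong (λ w → (t - r) * (w * h t + g r) + (r * g r + c)) (t≡[t-r]+r t r) ⟨
      (t - r) * (t * h t + g r) + (r * g r + c)     ≡⟨ cong ((t - r) * (t * h t + g r) +_) (f≡ r) ⟨
      (t - r) * (t * h t + g r) + f r               ∎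
    where
    open ≡-Reasoning
    regroup : ∀ u r h g c → (u + r) * (u * h + g) + c ≡ u * ((u + r) * h + g) + (r * g + c)
    regroup = solve 5 (λ u r h g c →
      ((u ⊕ r) ⊗ (u ⊗ h ⊕ g) ⊕ c) ⊜ (u ⊗ ((u ⊕ r) ⊗ h ⊕ g) ⊕ (r ⊗ g ⊕ c))) refl

  distinct-roots≤degree : ∀ {n f xs} → Polynomial n f → Unique xs → All (λ x → f x ≡ 0#) xs → length xs ≤ n
  distinct-roots≤degree {xs = []} _ _ _ = z≤n
  distinct-roots≤degree {xs = x ∷ _} (constant c c≢0 f≡c) _ (fx≡0 ∷ _) = contradiction (trans (sym (f≡c x)) fx≡0) c≢0
  distinct-roots≤degree {f = f} {xs = x ∷ xs} f-poly@(horner _ _ _) (x∉xs ∷ xs!) (fx≡0 ∷ fxs≡0)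
    with h , h-poly , f≡ ← factor-theorem f-poly x =
    s≤s (distinct-roots≤degree h-poly xs! (All.zipWith root-of-quotient (x∉xs , fxs≡0)))
    where
    root-of-quotient : ∀ {y} → x ≢ y × f y ≡ 0# → h y ≡ 0#
    root-of-quotient {y} (x≢y , fy≡0) = x≢0∧xy≡0⇒y≡0 (x≢y ∘ sym ∘ x-y≡0⇒x≡y y x) (begin
      (y - x) * h y        ≡⟨ +-identityʳ _ ⟨
      (y - x) * h y + 0#   ≡⟨ cong ((y - x) * h y +_) fx≡0 ⟨
      (y - x) * h y + f x  ≡⟨ f≡ y ⟨
      f y                  ≡⟨ fy≡0 ⟩
      0#                   ∎)
      where open ≡-Reasoning

  monomial : ∀ n → Polynomial n (_^ n)
  monomial zero    = constant 1# 1≢0 (λ _ → refl)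
  monomial (suc n) = horner 0# (monomial n) (λ _ → sym (+-identityʳ _))

  monomial+constant : ∀ n ⦃ _ : NonZero n ⦄ c → Polynomial n (λ t → t ^ n + c)
  monomial+constant (suc n) c = horner c (monomial n) (λ _ → refl)

  Polynomial-+-constant : ∀ {n f} → Polynomial (suc n) f → ∀ c → Polynomial (suc n) (λ t → f t + c)
  Polynomial-+-constant (horner c₀ g-poly f≡) c = horner (c₀ + c) g-poly (λ t → trans (cong (_+ c) (f≡ t)) (+-assoc _ c₀ c))

  Polynomial-monomial-* : ∀ n {e g} → Polynomial e g → Polynomial (n ℕ.+ e) (λ t → t ^ n * g t)
  Polynomial-monomial-* zero    g-poly = Polynomial-cong (λ t → *-identityˡ _) g-poly
  Polynomial-monomial-* (suc n) {g = g} g-poly =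
    horner 0# (Polynomial-monomial-* n g-poly) (λ t → trans (*-assoc t (t ^ n) (g t)) (sym (+-identityʳ _)))

  geometric : Carrier → ℕ → Carrier
  geometric y zero    = 0#
  geometric y (suc j) = 1# + y * geometric y j

  geometric-shift : ∀ y j → y * geometric y j + 1# ≡ geometric y j + y ^ j
  geometric-shift y zero    = cong (_+ 1#) (zeroʳ y)
  geometric-shift y (suc j) = begin
    y * (1# + y * G) + 1#     ≡⟨ cong (λ w → y * w + 1#) (+-comm 1# (y * G)) ⟩
    y * (y * G + 1#) + 1#     ≡⟨ cong (λ w → y * w + 1#) (geometric-shift y j) ⟩
    y * (G + y ^ j) + 1#      ≡⟨ regroup y G (y ^ j) 1# ⟩
    (1# + y * G) + y * y ^ j  ∎
    where
    open ≡-Reasoning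
    G = geometric y j
    regroup : ∀ y G P o → y * (G + P) + o ≡ (o + y * G) + y * P
    regroup = solve 4 (λ y G P o → (y ⊗ (G ⊕ P) ⊕ o) ⊜ ((o ⊕ y ⊗ G) ⊕ y ⊗ P)) refl

  geometric-root : ∀ {y} j → y ≢ 1# → y ^ j ≡ 1# → geometric y j ≡ 0#
  geometric-root {y} j y≢1 yʲ≡1 with geometric y j ≟ 0#
  ... | yes G≡0 = G≡0
  ... | no  G≢0 = contradiction (*-cancelʳ-nonZero (geometric y j) y 1# G≢0 yG≡1G) y≢1
    where
    yG≡1G : y * geometric y j ≡ 1# * geometric y j
    yG≡1G = trans (+-cancelʳ 1# _ _ (trans (geometric-shift y j) (cong (geometric y j +_) yʲ≡1)))
                  (sym (*-identityˡ _))

  geometric-polynomial : ∀ m ⦃ _ : NonZero m ⦄ j → Polynomial (j ℕ.* m) (λ t → geometric (t ^ m) (suc j))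
  geometric-polynomial m zero = constant 1# 1≢0 (λ t → trans (cong (1# +_) (zeroʳ _)) (+-identityʳ 1#))
  geometric-polynomial m@(suc _) (suc j) = Polynomial-cong (λ t → +-comm 1# _)
    (Polynomial-+-constant (Polynomial-monomial-* m (geometric-polynomial m j)) 1#)

  roots : (Carrier → Carrier) → List Carrier
  roots g = filter (λ x → g x ≟ 0#) elements

  roots-unique : ∀ g → Unique (roots g)
  roots-unique g = Unique.filter⁺ (λ x → g x ≟ 0#) elements-unique

  roots-vanish : ∀ g → All (λ x → g x ≡ 0#) (roots g)
  roots-vanish g = All.all-filter (λ x → g x ≟ 0#) elements

  length-roots≤degree : ∀ {n g} → Polynomial n g → length (roots g) ≤ n
  length-roots≤degree {g = g} g-poly = distinct-roots≤degree g-poly (roots-unique g) (roots-vanish g)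

  q≤length-roots+degree : ∀ {n g h} → Polynomial n h → (∀ {x} → g x ≢ 0# → h x ≡ 0#) → q ≤ length (roots g) ℕ.+ n
  q≤length-roots+degree {n} {g} h-poly h-vanishes = begin
    q                                         ≡⟨ elements-size ⟨
    length elements                           ≡⟨ length-filter+length-filter-∁ (λ x → g x ≟ 0#) elements ⟨
    length (roots g) ℕ.+ length nonroots      ≤⟨ ℕ.+-monoʳ-≤ (length (roots g)) (distinct-roots≤degree h-poly
                                                   (Unique.filter⁺ (∁? (λ x → g x ≟ 0#)) elements-unique)
                                                   (All.map h-vanishes (All.all-filter (∁? (λ x → g x ≟ 0#)) elements))) ⟩
    length (roots g) ℕ.+ n                    ∎
    where
    open ℕ.≤-Reasoning
    nonroots = filter (∁? (λ x → g x ≟ 0#)) elements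

  -- Lines of PG(2,q) meeting S_f

  ∞ : Triple
  ∞ = (0# , 1# , 0#)

  affineRoots : (Carrier → Carrier) → Triple → List Carrier
  affineRoots g L = roots (λ x → dot (x , g x , 1#) L)

  S-cong : ∀ {f g} → (∀ x → f x ≡ g x) → S f ≡ S g
  S-cong f≗g = cong (_++ ∞ ∷ []) (List.map-cong (λ x → cong (λ y → (x , y , 1#)) (f≗g x)) elements)

  pointsOn-S : ∀ g L → pointsOn (S g) L ≡ length (affineRoots g L) ℕ.+ pointsOn (∞ ∷ []) L
  pointsOn-S g L = begin
    length (filter P? (map (λ x → (x , g x , 1#)) elements ++ ∞ ∷ []))
      ≡⟨ cong length (List.filter-++ P? (map (λ x → (x , g x , 1#)) elements) (∞ ∷ [])) ⟩
    length (filter P? (map (λ x → (x , g x , 1#)) elements) ++ filter P? (∞ ∷ []))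
      ≡⟨ List.length-++ (filter P? (map (λ x → (x , g x , 1#)) elements)) ⟩
    length (filter P? (map (λ x → (x , g x , 1#)) elements)) ℕ.+ pointsOn (∞ ∷ []) L
      ≡⟨ cong (ℕ._+ pointsOn (∞ ∷ []) L) (length-filter-map P? (λ x → (x , g x , 1#)) elements) ⟩
    length (affineRoots g L) ℕ.+ pointsOn (∞ ∷ []) L
      ∎
    where
    open ≡-Reasoning
    P? = λ P → dot P L ≟ 0#

  pointsOn-S-∞∉ : ∀ g L → dot ∞ L ≢ 0# → pointsOn (S g) L ≡ length (affineRoots g L)
  pointsOn-S-∞∉ g L ∞∉L = trans (pointsOn-S g L)
    (trans (cong (λ P → length (affineRoots g L) ℕ.+ length P) (List.filter-reject (λ P → dot P L ≟ 0#) ∞∉L))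
           (ℕ.+-identityʳ _))

  dot-∞ : ∀ a b c → dot ∞ (a , b , c) ≡ b
  dot-∞ a b c = begin
    a * 0# + b * 1# + c * 0#   ≡⟨ cong₂ (λ u v → u + b * 1# + v) (zeroʳ a) (zeroʳ c) ⟩
    0# + b * 1# + 0#           ≡⟨ trans (+-identityʳ _) (trans (+-identityˡ _) (*-identityʳ b)) ⟩
    b                          ∎
    where open ≡-Reasoning

  b≢0⇒∞∉L : ∀ {a b c} → b ≢ 0# → dot ∞ (a , b , c) ≢ 0#
  b≢0⇒∞∉L {a} {b} {c} b≢0 = b≢0 ∘ trans (sym (dot-∞ a b c))

  pointsOn-S≤ : ∀ g L → pointsOn (S g) L ≤ length (affineRoots g L) ℕ.+ 1
  pointsOn-S≤ g L = subst (_≤ length (affineRoots g L) ℕ.+ 1) (sym (pointsOn-S g L))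
    (ℕ.+-monoʳ-≤ (length (affineRoots g L)) (List.length-filter (λ P → dot P L ≟ 0#) (∞ ∷ [])))

  vertical-dot : ∀ a c x y → dot (x , y , 1#) (a , 0# , c) ≡ x * a + c
  vertical-dot a c x y = begin
    a * x + 0# * y + c * 1#   ≡⟨ cong₂ (λ u v → a * x + u + v) (zeroˡ y) (*-identityʳ c) ⟩
    a * x + 0# + c            ≡⟨ cong (_+ c) (trans (+-identityʳ _) (*-comm a x)) ⟩
    x * a + c                 ∎
    where open ≡-Reasoning

  length-affineRoots-vertical : ∀ g {a c} → a ≢ 0# ⊎ c ≢ 0# → length (affineRoots g (a , 0# , c)) ≤ 1
  length-affineRoots-vertical g {a} {c} (inj₁ a≢0) =
    length-roots≤degree (horner c (constant a a≢0 (λ _ → refl)) (λ x → vertical-dot a c x (g x)))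
  length-affineRoots-vertical g {a} {c} (inj₂ c≢0) with a ≟ 0#
  ... | no a≢0 = length-affineRoots-vertical g (inj₁ a≢0)
  ... | yes refl = ℕ.≤-trans (length-roots≤degree (constant c c≢0 (λ x →
                     trans (vertical-dot 0# c x (g x)) (trans (cong (_+ c) (zeroʳ x)) (+-identityˡ c))))) z≤n

  pointsOn-S-vertical : ∀ g {a c} → a ≢ 0# ⊎ c ≢ 0# → pointsOn (S g) (a , 0# , c) ≤ 2
  pointsOn-S-vertical g a≢0⊎c≢0 = ℕ.≤-trans (pointsOn-S≤ g _) (ℕ.+-monoˡ-≤ 1 (length-affineRoots-vertical g a≢0⊎c≢0))

  All-lines : ∀ {P : Triple → Set} → (∀ a b → P (a , b , 1#)) → (∀ a → P (a , 1# , 0#)) → P (1# , 0# , 0#) →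
              All P lines
  All-lines affine slope vertical = All.++⁺
    (All.concat⁺ (All.map⁺ (All.universal (λ a → All.map⁺ (All.universal (affine a) elements)) elements)))
    (All.++⁺ (All.map⁺ (All.universal slope elements)) (vertical ∷ []))

  slope∈lines : ∀ a → (a , 1# , 0#) ∈ lines
  slope∈lines a = ∈.∈-++⁺ʳ (concatMap (λ x → map (λ y → (x , y , 1#)) elements) elements)
                    (∈.∈-++⁺ˡ (∈.∈-map⁺ (λ x → (x , 1# , 0#)) (elements-complete a)))

  HasDegree-intro : ∀ {P k L} → All (λ L → pointsOn P L ≤ k) lines → L ∈ lines → pointsOn P L ≡ k →
                    HasDegree P k
  HasDegree-intro {P} {k} bounded L∈lines L-attains = u[k]≢0 , u[>k]≡0
    where
    u[k]≢0 : u k P ≢ 0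
    u[k]≢0 u[k]≡0 = ℕ.<⇒≢ (List.filter-some (λ L → pointsOn P L ℕ.≟ k) (lose L∈lines L-attains)) (sym u[k]≡0)
    u[>k]≡0 : ∀ i → k ℕ.< i → u i P ≡ 0
    u[>k]≡0 i k<i = cong length (List.filter-none (λ L → pointsOn P L ℕ.≟ i)
                      (All.map (λ ≤k ≡i → ℕ.<⇒≱ k<i (subst (_≤ k) ≡i ≤k)) bounded))

  -- The curve y = x^(D+1)

  module _ (D : ℕ) where

    instance
      gcd-nonZero : NonZero (gcd D (q ∸ 1))
      gcd-nonZero = ℕ.≢-nonZero (gcd[m,n]≢0 D (q ∸ 1) (inj₂ (ℕ.≢-nonZero⁻¹ (q ∸ 1))))

    xᴰ≡yᴰ⇒xᵐ≡yᵐ : ∀ {x y} → x ≢ 0# → y ≢ 0# → x ^ D ≡ y ^ D → x ^ gcd D (q ∸ 1) ≡ y ^ gcd D (q ∸ 1)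
    xᴰ≡yᴰ⇒xᵐ≡yᵐ {x} {y} x≢0 y≢0 xᴰ≡yᴰ with Bézout.identity (gcd-GCD D (q ∸ 1))
    ... | +- X Y m+Y[q∸1]≡XD = trans (lift x≢0) (trans (cong (_^ X) xᴰ≡yᴰ) (sym (lift y≢0)))
      where
      m = gcd D (q ∸ 1)
      lift : ∀ {z} → z ≢ 0# → z ^ m ≡ (z ^ D) ^ X
      lift {z} z≢0 = begin
        z ^ m                          ≡⟨ *-identityʳ _ ⟨
        z ^ m * 1#                     ≡⟨ cong (z ^ m *_) (fermat-multiple z≢0 Y) ⟨
        z ^ m * z ^ (Y ℕ.* (q ∸ 1))    ≡⟨ ^-homo-* z m _ ⟨
        z ^ (m ℕ.+ Y ℕ.* (q ∸ 1))      ≡⟨ cong (z ^_) (trans m+Y[q∸1]≡XD (ℕ.*-comm X D)) ⟩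
        z ^ (D ℕ.* X)                  ≡⟨ ^-assocʳ z D X ⟨
        (z ^ D) ^ X                    ∎
        where open ≡-Reasoning
    ... | -+ X Y m+XD≡Y[q∸1] = *-cancelʳ-nonZero ((x ^ D) ^ X) (x ^ m) (y ^ m) (^-nonZero X (^-nonZero D x≢0))
      (trans (invert x≢0) (trans (sym (invert y≢0)) (cong (λ w → y ^ m * w ^ X) (sym xᴰ≡yᴰ))))
      where
      m = gcd D (q ∸ 1)
      invert : ∀ {z} → z ≢ 0# → z ^ m * (z ^ D) ^ X ≡ 1#
      invert {z} z≢0 = begin
        z ^ m * (z ^ D) ^ X            ≡⟨ cong (z ^ m *_) (^-assocʳ z D X) ⟩
        z ^ m * z ^ (D ℕ.* X)          ≡⟨ ^-homo-* z m _ ⟨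
        z ^ (m ℕ.+ D ℕ.* X)            ≡⟨ cong (λ n → z ^ (m ℕ.+ n)) (ℕ.*-comm D X) ⟩
        z ^ (m ℕ.+ X ℕ.* D)            ≡⟨ cong (z ^_) m+XD≡Y[q∸1] ⟩
        z ^ (Y ℕ.* (q ∸ 1))            ≡⟨ fermat-multiple z≢0 Y ⟩
        1#                             ∎
        where open ≡-Reasoning

    slope-dot : ∀ a x → dot (x , x ^ suc D , 1#) (a , 1# , 0#) ≡ x * (a + x ^ D)
    slope-dot a x = begin
      a * x + 1# * (x * x ^ D) + 0# * 1#   ≡⟨ cong₂ (λ u v → a * x + u + v) (*-identityˡ _) (zeroˡ 1#) ⟩
      a * x + x * x ^ D + 0#               ≡⟨ +-identityʳ _ ⟩
      a * x + x * x ^ D                    ≡⟨ factor-x a x (x ^ D) ⟩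
      x * (a + x ^ D)                      ∎
      where
      open ≡-Reasoning
      factor-x : ∀ a x p → a * x + x * p ≡ x * (a + p)
      factor-x = solve 3 (λ a x p → (a ⊗ x ⊕ x ⊗ p) ⊜ (x ⊗ (a ⊕ p))) refl

    affine-dot : ∀ a b x → dot (x , x ^ suc D , 1#) (a , b , 1#) ≡ x * (a + b * x ^ D) + 1#
    affine-dot a b x = cong₂ _+_ (factor-x a b x (x ^ D)) (*-identityˡ 1#)
      where
      factor-x : ∀ a b x p → a * x + b * (x * p) ≡ x * (a + b * p)
      factor-x = solve 4 (λ a b x p → (a ⊗ x ⊕ b ⊗ (x ⊗ p)) ⊜ (x ⊗ (a ⊕ b ⊗ p))) refl

    length-affineRoots-slope : ∀ a → length (affineRoots (_^ suc D) (a , 1# , 0#)) ≤ suc (gcd D (q ∸ 1))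
    length-affineRoots-slope a with all? (_≟ 0#) (affineRoots (_^ suc D) (a , 1# , 0#))
    ... | yes all-zero = ℕ.≤-trans
      (distinct-roots≤degree (monomial 1) (roots-unique _) (All.map (λ x≡0 → trans (cong (_^ 1) x≡0) (zeroˡ 1#)) all-zero))
      (s≤s z≤n)
    ... | no not-all-zero with x₀ , x₀∈rs , x₀≢0 ← find (All.¬All⇒Any¬ (_≟ 0#) _ not-all-zero) =
      distinct-roots≤degree (horner 0# (monomial+constant m (- (x₀ ^ m))) (λ _ → refl)) (roots-unique _)
        (All.map (λ {x} → transfer x ∘ trans (sym (slope-dot a x))) (roots-vanish _))
      where
      m = gcd D (q ∸ 1)
      a+x₀ᴰ≡0 : a + x₀ ^ D ≡ 0#
      a+x₀ᴰ≡0 = x≢0∧xy≡0⇒y≡0 x₀≢0 (trans (sym (slope-dot a x₀)) (All.lookup (roots-vanish _) x₀∈rs))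
      transfer : ∀ x → x * (a + x ^ D) ≡ 0# → x * (x ^ m - x₀ ^ m) + 0# ≡ 0#
      transfer x root with x ≟ 0#
      ... | yes refl = trans (+-identityʳ _) (zeroˡ _)
      ... | no  x≢0  = begin
        x * (x ^ m - x₀ ^ m) + 0#   ≡⟨ +-identityʳ _ ⟩
        x * (x ^ m - x₀ ^ m)        ≡⟨ cong (x *_) (x≡y⇒x-y≡0 (xᴰ≡yᴰ⇒xᵐ≡yᵐ x≢0 x₀≢0 xᴰ≡x₀ᴰ)) ⟩
        x * 0#                      ≡⟨ zeroʳ x ⟩
        0#                          ∎
        where
        open ≡-Reasoning
        xᴰ≡x₀ᴰ : x ^ D ≡ x₀ ^ D
        xᴰ≡x₀ᴰ = +-cancelˡ a _ _ (trans (x≢0∧xy≡0⇒y≡0 x≢0 root) (sym a+x₀ᴰ≡0))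

    length-affineRoots-offOrigin : ∀ k ⦃ _ : NonZero k ⦄ → (∀ {x} → x ≢ 0# → (x ^ D) ^ k ≡ 1#) →
                                ∀ a {b} → b ≢ 0# → length (affineRoots (_^ suc D) (a , b , 1#)) ≤ k
    length-affineRoots-offOrigin k Dth-powers-are-kth-roots a {b} b≢0 =
      subst (_≤ k) (List.length-map (_^ D) rs)
        (distinct-roots≤degree (monomial+constant k (- 1#)) (Unique-map⁺-on determined-by-Dth-power is-root (roots-unique _))
          (All.map⁺ (All.map (x≡y⇒x-y≡0 ∘ Dth-powers-are-kth-roots ∘ x*c+1≡0⇒x≢0) is-root)))
      where
      rs = affineRoots (_^ suc D) (a , b , 1#)
      Root : Carrier → Set
      Root x = x * (a + b * x ^ D) + 1# ≡ 0#
      is-root : All Root rs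
      is-root = All.map (λ {x} → trans (sym (affine-dot a b x))) (roots-vanish _)
      determined-by-Dth-power : ∀ {x y} → Root x → Root y → x ^ D ≡ y ^ D → x ≡ y
      determined-by-Dth-power {x} {y} x-root y-root xᴰ≡yᴰ =
        *-cancelʳ-nonZero c x y (x*c+1≡0⇒c≢0 x-root) (+-cancelʳ 1# _ _ (trans x-root (sym y-root′)))
        where
        c = a + b * x ^ D
        y-root′ : y * c + 1# ≡ 0#
        y-root′ = subst (λ w → y * (a + b * w) + 1# ≡ 0#) (sym xᴰ≡yᴰ) y-root

    length-affineRoots-diagonal : ∀ {m} ⦃ _ : NonZero m ⦄ → m ∣ D → m ∣ q ∸ 1 →
                                  suc m ≤ length (affineRoots (_^ suc D) (- 1# , 1# , 0#))
    length-affineRoots-diagonal (divides _ _) (divides zero q∸1≡0) = contradiction q∸1≡0 (ℕ.≢-nonZero⁻¹ (q ∸ 1))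
    length-affineRoots-diagonal {m} (divides G D≡Gm) (divides (suc j) q∸1≡[1+j]m) =
      ℕ.+-cancelʳ-≤ (j ℕ.* m) (suc m) _
        (subst (_≤ length (affineRoots (_^ suc D) L) ℕ.+ j ℕ.* m) (trans q≡1+[q∸1] (cong suc q∸1≡[1+j]m))
          (q≤length-roots+degree (geometric-polynomial m j) nonroot-vanishes))
      where
      open ≡-Reasoning
      L = (- 1# , 1# , 0#)
      nonroot-vanishes : ∀ {x} → dot (x , x ^ suc D , 1#) L ≢ 0# → geometric (x ^ m) (suc j) ≡ 0#
      nonroot-vanishes {x} nonroot = geometric-root (suc j) xᵐ≢1 xᵐ⁽¹⁺ʲ⁾≡1
        where
        x≢0 : x ≢ 0#
        x≢0 refl = nonroot (trans (slope-dot (- 1#) 0#) (zeroˡ _))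
        xᵐ≢1 : x ^ m ≢ 1#
        xᵐ≢1 xᵐ≡1 = nonroot (begin
          dot (x , x ^ suc D , 1#) L   ≡⟨ slope-dot (- 1#) x ⟩
          x * (- 1# + x ^ D)           ≡⟨ cong (λ n → x * (- 1# + x ^ n)) (trans D≡Gm (ℕ.*-comm G m)) ⟩
          x * (- 1# + x ^ (m ℕ.* G))   ≡⟨ cong (λ w → x * (- 1# + w)) (^-assocʳ x m G) ⟨
          x * (- 1# + (x ^ m) ^ G)     ≡⟨ cong (λ w → x * (- 1# + w ^ G)) xᵐ≡1 ⟩
          x * (- 1# + 1# ^ G)          ≡⟨ cong (λ w → x * (- 1# + w)) (1^n≡1 G) ⟩
          x * (- 1# + 1#)              ≡⟨ cong (x *_) (-‿inverseˡ 1#) ⟩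
          x * 0#                       ≡⟨ zeroʳ x ⟩
          0#                           ∎)
        xᵐ⁽¹⁺ʲ⁾≡1 : (x ^ m) ^ suc j ≡ 1#
        xᵐ⁽¹⁺ʲ⁾≡1 = begin
          (x ^ m) ^ suc j              ≡⟨ ^-assocʳ x m (suc j) ⟩
          x ^ (m ℕ.* suc j)            ≡⟨ cong (x ^_) (trans (ℕ.*-comm m (suc j)) (sym q∸1≡[1+j]m)) ⟩
          x ^ (q ∸ 1)                  ≡⟨ fermat x≢0 ⟩
          1#                           ∎

    Dth-powers-are-kth-roots : ∀ {k} → q ∸ 1 ∣ D ℕ.* k → ∀ {x} → x ≢ 0# → (x ^ D) ^ k ≡ 1#
    Dth-powers-are-kth-roots {k} (divides G Dk≡G[q∸1]) {x} x≢0 = begin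
      (x ^ D) ^ k               ≡⟨ ^-assocʳ x D k ⟩
      x ^ (D ℕ.* k)             ≡⟨ cong (x ^_) Dk≡G[q∸1] ⟩
      x ^ (G ℕ.* (q ∸ 1))       ≡⟨ fermat-multiple x≢0 G ⟩
      1#                        ∎
      where open ≡-Reasoning

    S-power-degree : q ∸ 1 ≤ gcd D (q ∸ 1) ℕ.* suc (gcd D (q ∸ 1)) →
                     HasDegree (S (_^ suc D)) (suc (gcd D (q ∸ 1)))
    S-power-degree q∸1≤m[1+m] =
      HasDegree-intro {S (_^ suc D)} (All-lines offOrigin slope vertical) (slope∈lines (- 1#)) diagonal
      where
      m = gcd D (q ∸ 1)
      open _∣_ (gcd[m,n]∣n D (q ∸ 1)) using () renaming (quotient to k; equality to q∸1≡km)

      instance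
        k-nonZero : NonZero k
        k-nonZero = ℕ.≢-nonZero (λ k≡0 → ℕ.≢-nonZero⁻¹ (q ∸ 1) (trans q∸1≡km (cong (ℕ._* m) k≡0)))

      q∸1∣Dk : q ∸ 1 ∣ D ℕ.* k
      q∸1∣Dk = subst (_∣ D ℕ.* k) (trans (ℕ.*-comm m k) (sym q∸1≡km)) (*-monoˡ-∣ k (gcd[m,n]∣m D (q ∸ 1)))

      k≤1+m : k ≤ suc m
      k≤1+m = ℕ.*-cancelʳ-≤ k (suc m) m (subst₂ _≤_ q∸1≡km (ℕ.*-comm m (suc m)) q∸1≤m[1+m])

      2≤1+m : 2 ≤ suc m
      2≤1+m = s≤s (ℕ.>-nonZero⁻¹ m)

      offOrigin : ∀ a b → pointsOn (S (_^ suc D)) (a , b , 1#) ≤ suc m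
      offOrigin a b with b ≟ 0#
      ... | yes refl = ℕ.≤-trans (pointsOn-S-vertical _ (inj₂ 1≢0)) 2≤1+m
      ... | no  b≢0  = subst (_≤ suc m) (sym (pointsOn-S-∞∉ _ _ (b≢0⇒∞∉L b≢0)))
        (ℕ.≤-trans (length-affineRoots-offOrigin k (Dth-powers-are-kth-roots q∸1∣Dk) a b≢0) k≤1+m)

      slope : ∀ a → pointsOn (S (_^ suc D)) (a , 1# , 0#) ≤ suc m
      slope a = subst (_≤ suc m) (sym (pointsOn-S-∞∉ _ _ (b≢0⇒∞∉L 1≢0))) (length-affineRoots-slope a)

      vertical : pointsOn (S (_^ suc D)) (1# , 0# , 0#) ≤ suc m
      vertical = ℕ.≤-trans (pointsOn-S-vertical _ (inj₁ 1≢0)) 2≤1+m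

      diagonal : pointsOn (S (_^ suc D)) (- 1# , 1# , 0#) ≡ suc m
      diagonal = ℕ.≤-antisym (slope (- 1#)) (subst (suc m ≤_) (sym (pointsOn-S-∞∉ _ _ (b≢0⇒∞∉L 1≢0)))
        (length-affineRoots-diagonal (gcd[m,n]∣m D (q ∸ 1)) (gcd[m,n]∣n D (q ∸ 1))))

open import Data.Nat using (_*_)

corollary3p11 : ∀ {q : ℕ} → IsPrimePower q → (F : FiniteField q) → (d : ℕ) → 1 ≤ d → q ∸ 1 ≤ gcd (d ∸ 1) (q ∸ 1) * suc (gcd (d ∸ 1) (q ∸ 1)) → PG2.HasDegree F (PG2.S F (λ x → PG2.pow F x d)) (suc (gcd (d ∸ 1) (q ∸ 1)))
corollary3p11 _ _ zero () _
corollary3p11 _ F (suc D) _ q∸1≤m[1+m] =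
  subst (λ P → PG2.HasDegree F P _) (S-cong F (λ x → sym (pow≡^ F x (suc D)))) (S-power-degree F D q∸1≤m[1+m])
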